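{- Let $\mathbb{P}=(R,G)$ be a skew partial field, let $A$ be an $X\times Y$ strong $\mathbb{P}$-matrix, and let $x\in X$, $y\in Y$ be such that $A_{xy}\neq0$. Then $A^{xy}$ is a strong $\mathbb{P}$-matrix.
   Context: A skew partial field is a pair $\mathbb{P}=(R,G)$ with $R$ a (not necessarily commutative) ring with identity and $G$ a subgroup of the units $R^*$ with $-1\in G$. An $R$-chain group on a finite set $E$ is a subset of $R^E$ containing $0$ and closed under componentwise addition and left scalar multiplication. A chain $c$ is elementary in $C$ if $c\ne0$ and no nonzero chain of $C$ has support strictly contained in $\|c\|=\{e:c_e\ne0\}$; $c$ is $G$-primitive if its entries lie in $G\cup\{0\}$. A $\mathbb{P}$-chain group is an $R$-chain group in which every elementary chain equals $rc'$ with $r\in R$, $c'$ a $G$-primitive chain of the group. For a matrix $A$ with row index set $X$, $\operatorname{rowspan}(A)=\{zA:z\in R^X\}$. $A$ is a weak $\mathbb{P}$-matrix if $\operatorname{rowspan}(A)$ is a $\mathbb{P}$-chain group, and a strong $\mathbb{P}$-matrix if $[I\ A]$ is a weak $\mathbb{P}$-matrix (nonzero entries of a strong $\mathbb{P}$-matrix lie in $G$, so the pivot below is defined). Pivot: for an $X\times Y$ matrix $A$ and $x\in X,y\in Y$ with $A_{xy}\in R^*$, $A^{xy}$ is the $((X\setminus x)\cup y)\times((Y\setminus y)\cup x)$ matrix with $(A^{xy})_{yx}=A_{xy}^{ -1}$; $(A^{xy})_{yv}=A_{xy}^{ -1}A_{xv}$ for $v\ne x$; $(A^{xy})_{ux}=-A_{uy}A_{xy}^{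 -1}$ for $u\ne y$; and $(A^{xy})_{uv}=A_{uv}-A_{uy}A_{xy}^{ -1}A_{xv}$ otherwise. -}

module Defs where

open import Level using (Level; _⊔_)
open import Algebra.Bundles using (Ring)
open import Data.Nat using (ℕ)
import Data.Nat as ℕ
open import Data.Fin using (Fin; zero; suc; _≟_)
open import Data.Bool using (Bool; true; false; if_then_else_)
open import Data.Product using (Σ; Σ-syntax; ∃; ∃-syntax; _×_; _,_)
open import Data.Sum using (_⊎_)
open import Relation.Nullary using (¬_; yes; no)
open import Relation.Binary.PropositionalEquality using (_≡_)

record SkewPartialField (c ℓ g : Level) : Set (Level.suc (c ⊔ ℓ ⊔ g)) where
  field
    ring : Ring c ℓ
  open Ring ring public
  field
    G       : Carrier → Set g
    G-resp  : ∀ {a b} → a ≈ b → G a → G b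
    G-one   : G 1#
    G-mul   : ∀ {a b} → G a → G b → G (a * b)
    G-inv   : ∀ {a} → G a → Σ[ b ∈ Carrier ] (G b × (a * b ≈ 1#) × (b * a ≈ 1#))
    G-neg1  : G (- 1#)

module _ {c ℓ g : Level} (P : SkewPartialField c ℓ g) where
  open SkewPartialField P using (Carrier; _≈_; _+_; _*_; -_; _-_; 0#; 1#; G)

  Σᶠ : ∀ {n} → (Fin n → Carrier) → Carrier
  Σᶠ {ℕ.zero}  f = 0#
  Σᶠ {ℕ.suc n} f = f zero + Σᶠ (λ i → f (suc i))

  Chain : ℕ → Set c
  Chain n = Fin n → Carrier

  ChainSet : ℕ → Set (Level.suc (c ⊔ ℓ))
  ChainSet n = Chain n → Set (c ⊔ ℓ)

  InSupp : ∀ {n} → Chain n → Fin n → Set ℓ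
  InSupp x e = ¬ (x e ≈ 0#)

  NonZero : ∀ {n} → Chain n → Set ℓ
  NonZero x = ∃[ e ] InSupp x e

  StrictSubSupp : ∀ {n} → Chain n → Chain n → Set ℓ
  StrictSubSupp d x = (∀ e → InSupp d e → InSupp x e) × (∃[ e ] (InSupp x e × d e ≈ 0#))

  Elementary : ∀ {n} → ChainSet n → Chain n → Set (c ⊔ ℓ)
  Elementary C x = C x × NonZero x ×
    ¬ (Σ[ d ∈ Chain _ ] (C d × NonZero d × StrictSubSupp d x))

  Primitive : ∀ {n} → Chain n → Set (ℓ ⊔ g)
  Primitive x = ∀ e → G (x e) ⊎ x e ≈ 0#

  -- P-chain group condition (rowspans are automatically R-chain groups)
  IsPChainGroup : ∀ {n} → ChainSet n → Set (c ⊔ ℓ ⊔ g)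
  IsPChainGroup C = ∀ x → Elementary C x →
    Σ[ r ∈ Carrier ] Σ[ x' ∈ Chain _ ] (C x' × Primitive x' × (∀ e → x e ≈ r * x' e))

  -- A matrix with row set X ⊆ E and column set E (or a subset), E = Fin n.
  -- Row set given by a Boolean predicate X : Fin n → Bool; entries outside
  -- the relevant index sets are ignored.
  Mat : ℕ → Set c
  Mat n = Fin n → Fin n → Carrier

  rowspan : ∀ {n} → (Fin n → Bool) → Mat n → ChainSet n
  rowspan X M x = Σ[ z ∈ Chain _ ] (∀ e → x e ≈ Σᶠ (λ r → if X r then z r * M r e else 0#))

  -- [I A] for an X × Y matrix A with Y = E \ X : rows X, columns E
  IA : ∀ {n} → (Fin n → Bool) → Mat n → Mat n
  IA X A r e with X e
  ... | true with r ≟ e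
  ...   | yes _ = 1#
  ...   | no  _ = 0#
  IA X A r e | false = A r e

  WeakPMatrix : ∀ {n} → (Fin n → Bool) → Mat n → Set (c ⊔ ℓ ⊔ g)
  WeakPMatrix X M = IsPChainGroup (rowspan X M)

  StrongPMatrix : ∀ {n} → (Fin n → Bool) → Mat n → Set (c ⊔ ℓ ⊔ g)
  StrongPMatrix X A = WeakPMatrix X (IA X A)

  pivotRows : ∀ {n} → (Fin n → Bool) → Fin n → Fin n → (Fin n → Bool)
  pivotRows X x y e with e ≟ x
  ... | yes _ = false
  ... | no _ with e ≟ y
  ...   | yes _ = true
  ...   | no _  = X e

  -- pivot A^{xy}, given the inverse a' of A_xy; rows (X\x)∪y, columns (Y\y)∪x
  pivot : ∀ {n} → Mat n → Fin n → Fin n → Carrier → Mat n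
  pivot A x y a' u v with u ≟ y | v ≟ x
  ... | yes _ | yes _ = a'
  ... | yes _ | no _  = a' * A x v
  ... | no _  | yes _ = - (A u y * a')
  ... | no _  | no _  = A u v - A u y * a' * A x v

  IsInverse : Carrier → Carrier → Set ℓ
  IsInverse a' a = (a' * a ≈ 1#) × (a * a' ≈ 1#)

-- The row x of [I A] is elementary in its row space C: an elementary chain d of C
-- with support strictly inside that of the row is r·c with c primitive; c vanishes
-- wherever d does, in particular on X∖{x}, so c = c_x·(row x) with c_x ∈ G, and
-- then c, hence d, has the full support of the row.  Writing the row itself as r·c
-- with c primitive, its entries 1 and A_xy force r, c_y ∈ G, so A_xy ∈ G is a unit.
-- Pivoting on A_xy is an invertible row operation: the rows of [I A^xy] are left
-- combinations of those of [I A] and conversely, so both have the same row space,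
-- and being a P-chain group depends only on the row space.

module Submission where

open import Defs
open import Level using (Level; _⊔_)
open import Data.Nat using (ℕ; _<_)
open import Data.Nat.Induction using (<-wellFounded)
open import Data.Fin using (Fin; zero; suc; _≟_; punchIn)
open import Data.Fin.Properties using (punchInᵢ≢i)
open import Data.Fin.Subset using (Subset; ⊤; _∈_; ∣_∣) renaming (_-_ to _without_)
open import Data.Fin.Subset.Properties using (∈⊤; x∈p∧x≢y⇒x∈p-y; x∈p⇒∣p-x∣<∣p∣)
open import Data.Bool using (Bool; true; false; if_then_else_)
open import Data.Product using (Σ-syntax; _×_; _,_; proj₂)
open import Data.Sum using (_⊎_; inj₁; inj₂)
open import Data.Empty using (⊥)
open import Function using (_∘_)
open import Induction.WellFounded using (Acc; acc)
open import Relation.Nullary using (¬_; contradiction; does; yes; no)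
open import Relation.Nullary.Decidable using (dec-yes; dec-no)
open import Relation.Binary.PropositionalEquality using (_≡_; _≢_)
import Relation.Binary.PropositionalEquality as ≡

module _ {ℓᶜ ℓ ℓᵍ : Level} (P : SkewPartialField ℓᶜ ℓ ℓᵍ) where
  open SkewPartialField P hiding (zero)
  open import Algebra.Properties.Ring ring using (-‿distribˡ-*)
  open import Algebra.Properties.Semiring.Sum semiring
    using (sum; sum-cong-≋; ∑-distrib-+; *-distribˡ-sum; sum-remove; sum-replicate-zero)
  open import Relation.Binary.Reasoning.Setoid setoid

  Σᶠ≡sum : ∀ {n} (f : Fin n → Carrier) → Σᶠ P f ≡ sum f
  Σᶠ≡sum {ℕ.zero}  f = ≡.refl
  Σᶠ≡sum {ℕ.suc n} f = ≡.cong (f zero +_) (Σᶠ≡sum (f ∘ suc))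

  Σᶠ-cong : ∀ {n} {f h : Fin n → Carrier} → (∀ i → f i ≈ h i) → Σᶠ P f ≈ Σᶠ P h
  Σᶠ-cong {f = f} {h} f≈h rewrite Σᶠ≡sum f | Σᶠ≡sum h = sum-cong-≋ f≈h

  Σᶠ-zero : ∀ {n} {f : Fin n → Carrier} → (∀ i → f i ≈ 0#) → Σᶠ P f ≈ 0#
  Σᶠ-zero {n} f≈0 =
    trans (Σᶠ-cong f≈0) (trans (reflexive (Σᶠ≡sum {n} (λ _ → 0#))) (sum-replicate-zero n))

  Σᶠ-+ : ∀ {n} (f h : Fin n → Carrier) → Σᶠ P (λ i → f i + h i) ≈ Σᶠ P f + Σᶠ P h
  Σᶠ-+ f h rewrite Σᶠ≡sum (λ i → f i + h i) | Σᶠ≡sum f | Σᶠ≡sum h = ∑-distrib-+ f h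

  Σᶠ-*ˡ : ∀ {n} a (f : Fin n → Carrier) → a * Σᶠ P f ≈ Σᶠ P (λ i → a * f i)
  Σᶠ-*ˡ a f rewrite Σᶠ≡sum f | Σᶠ≡sum (λ i → a * f i) = *-distribˡ-sum a f

  Σᶠ-single : ∀ {n} (f : Fin n → Carrier) (i : Fin n) → (∀ j → j ≢ i → f j ≈ 0#) → Σᶠ P f ≈ f i
  Σᶠ-single {ℕ.suc n} f i f≈0 = begin
    Σᶠ P f                             ≡⟨ Σᶠ≡sum f ⟩
    sum f                              ≈⟨ sum-remove {i = i} f ⟩
    f i + sum (λ j → f (punchIn i j))  ≡⟨ ≡.cong (f i +_) (Σᶠ≡sum (λ j → f (punchIn i j))) ⟨
    f i + Σᶠ P (λ j → f (punchIn i j)) ≈⟨ +-congˡ (Σᶠ-zero (λ j → f≈0 _ (punchInᵢ≢i i j))) ⟩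
    f i + 0#                           ≈⟨ +-identityʳ (f i) ⟩
    f i                                ∎

  if-0 : ∀ b {a} → a ≈ 0# → (if b then a else 0#) ≈ 0#
  if-0 true  a≈0 = a≈0
  if-0 false _   = refl

  combination : ∀ {n} → (Fin n → Bool) → Chain P n → Mat P n → Chain P n
  combination X z M e = Σᶠ P (λ r → if X r then z r * M r e else 0#)

  combination-single : ∀ {n} {X : Fin n → Bool} {z : Chain P n} (M : Mat P n) {s} → X s ≡ true →
    (∀ r → X r ≡ true → r ≢ s → z r ≈ 0#) → ∀ e → combination X z M e ≈ z s * M s e
  combination-single {X = X} {z} M {s} Xs z≈0 e =
    trans (Σᶠ-single _ s vanish) (reflexive (≡.cong (λ b → if b then z s * M s e else 0#) Xs))
    where
    vanish : ∀ r → r ≢ s → (if X r then z r * M r e else 0#) ≈ 0#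
    vanish r r≢s with X r in Xr
    ... | true  = trans (*-congʳ (z≈0 r Xr r≢s)) (zeroˡ (M r e))
    ... | false = refl

  rowspan-resp : ∀ {n} {X : Fin n → Bool} {M : Mat P n} {c d : Chain P n} →
    (∀ e → c e ≈ d e) → rowspan P X M c → rowspan P X M d
  rowspan-resp c≈d (z , c≈zM) = z , λ e → trans (sym (c≈d e)) (c≈zM e)

  rowspan-0 : ∀ {n} {X : Fin n → Bool} {M : Mat P n} → rowspan P X M (λ _ → 0#)
  rowspan-0 {X = X} {M} = (λ _ → 0#) , λ e → sym (Σᶠ-zero (λ r → if-0 (X r) (zeroˡ (M r e))))

  rowspan-+ : ∀ {n} {X : Fin n → Bool} {M : Mat P n} {c d : Chain P n} →
    rowspan P X M c → rowspan P X M d → rowspan P X M (λ e → c e + d e)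
  rowspan-+ {n} {X} {M} {c} {d} (z₁ , c≈) (z₂ , d≈) = (λ r → z₁ r + z₂ r) , λ e → begin
    c e + d e                                            ≈⟨ +-cong (c≈ e) (d≈ e) ⟩
    combination X z₁ M e + combination X z₂ M e          ≈⟨ Σᶠ-+ {n} _ _ ⟨
    Σᶠ P (λ r → (if X r then z₁ r * M r e else 0#) + (if X r then z₂ r * M r e else 0#))
                                                         ≈⟨ Σᶠ-cong (λ r → term-+ (X r) (z₁ r) (z₂ r) (M r e)) ⟩
    combination X (λ r → z₁ r + z₂ r) M e                ∎
    where
    term-+ : ∀ b a a' m →
      (if b then a * m else 0#) + (if b then a' * m else 0#) ≈ (if b then (a + a') * m else 0#)
    term-+ true  a a' m = sym (distribʳ m a a')
    term-+ false a a' m = +-identityʳ 0#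

  rowspan-*ˡ : ∀ {n} {X : Fin n → Bool} {M : Mat P n} {c : Chain P n} (k : Carrier) →
    rowspan P X M c → rowspan P X M (λ e → k * c e)
  rowspan-*ˡ {n} {X} {M} {c} k (z , c≈) = (λ r → k * z r) , λ e → begin
    k * c e                                              ≈⟨ *-congˡ (c≈ e) ⟩
    k * combination X z M e                              ≈⟨ Σᶠ-*ˡ {n} k _ ⟩
    Σᶠ P (λ r → k * (if X r then z r * M r e else 0#))   ≈⟨ Σᶠ-cong (λ r → term-*ˡ (X r) (z r) (M r e)) ⟩
    combination X (λ r → k * z r) M e                    ∎
    where
    term-*ˡ : ∀ b a m → k * (if b then a * m else 0#) ≈ (if b then k * a * m else 0#)
    term-*ˡ true  a m = sym (*-assoc k a m)
    term-*ˡ false a m = zeroʳ k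

  rowspan-Σᶠ : ∀ {n m} {X : Fin n → Bool} {M : Mat P n} (f : Fin m → Chain P n) →
    (∀ i → rowspan P X M (f i)) → rowspan P X M (λ e → Σᶠ P (λ i → f i e))
  rowspan-Σᶠ {m = ℕ.zero}  f f∈ = rowspan-0
  rowspan-Σᶠ {m = ℕ.suc m} f f∈ = rowspan-+ (f∈ zero) (rowspan-Σᶠ (f ∘ suc) (f∈ ∘ suc))

  rowspan-row : ∀ {n} {X : Fin n → Bool} {M : Mat P n} {s} → X s ≡ true → rowspan P X M (M s)
  rowspan-row {X = X} {M} {s} Xs = indicator , λ e → sym (begin
    combination X indicator M e ≈⟨ combination-single M Xs indicator≈0 e ⟩
    indicator s * M s e         ≡⟨ ≡.cong (λ d → (if does d then 1# else 0#) * M s e)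
                                          (proj₂ (dec-yes (s ≟ s) ≡.refl)) ⟩
    1# * M s e                  ≈⟨ *-identityˡ (M s e) ⟩
    M s e                       ∎)
    where
    indicator : Chain P _
    indicator r = if does (r ≟ s) then 1# else 0#
    indicator≈0 : ∀ r → X r ≡ true → r ≢ s → indicator r ≈ 0#
    indicator≈0 r _ r≢s rewrite dec-no (r ≟ s) r≢s = refl

  rowspan-⊆ : ∀ {n} {X₁ X₂ : Fin n → Bool} {M₁ M₂ : Mat P n} →
    (∀ s → X₁ s ≡ true → rowspan P X₂ M₂ (M₁ s)) → ∀ c → rowspan P X₁ M₁ c → rowspan P X₂ M₂ c
  rowspan-⊆ {X₁ = X₁} {X₂} {M₁} {M₂} rows∈ c (z , c≈) =
    rowspan-resp (λ e → sym (c≈ e)) (rowspan-Σᶠ _ term∈)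
    where
    term∈ : ∀ r → rowspan P X₂ M₂ (λ e → if X₁ r then z r * M₁ r e else 0#)
    term∈ r with X₁ r in X₁r
    ... | true  = rowspan-*ˡ (z r) (rows∈ r X₁r)
    ... | false = rowspan-0

  IsPChainGroup-resp : ∀ {n} {C D : ChainSet P n} → (∀ c → C c → D c) → (∀ c → D c → C c) →
    IsPChainGroup P C → IsPChainGroup P D
  IsPChainGroup-resp C⊆D D⊆C C-pcg c (Dc , nzc , minimal)
    with C-pcg c (D⊆C c Dc , nzc , λ (d , Cd , rest) → minimal (d , C⊆D d Cd , rest))
  ... | r , c' , Cc' , c'-primitive , c≈rc' = r , c' , C⊆D c' Cc' , c'-primitive , c≈rc'

  Elementary-by-descent : ∀ {n} {C : ChainSet P n} {c : Chain P n} → C c → NonZero P c →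
    (∀ d → Elementary P C d → ¬ StrictSubSupp P d c) → Elementary P C c
  Elementary-by-descent {n} {C} {c} Cc c≢0 no-elementary-below =
    Cc , c≢0 , no-chain-below ⊤ (<-wellFounded ∣ ⊤ {n} ∣) c (λ _ _ → ∈⊤) (λ _ e∈c → e∈c)
    where
    NoChainBelow : Chain P n → Set (ℓᶜ ⊔ ℓ)
    NoChainBelow d = ¬ (Σ[ d' ∈ Chain P n ] (C d' × NonZero P d' × StrictSubSupp P d' d))
    -- Supports are not decidable, so the descent is measured by a finite set p
    -- that over-approximates the support of d and loses one point per step.
    no-chain-below : ∀ (p : Subset n) → Acc _<_ ∣ p ∣ → ∀ d → (∀ e → InSupp P d e → e ∈ p) →
      (∀ e → InSupp P d e → InSupp P c e) → NoChainBelow d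
    no-chain-below p (acc smaller) d d⊆p d⊆c (d' , Cd' , d'≢0 , d'⊆d , e₀ , e₀∈d , d'e₀≈0) =
      no-elementary-below d'
        (Cd' , d'≢0 ,
          no-chain-below (p without e₀) (smaller (x∈p⇒∣p-x∣<∣p∣ (d⊆p e₀ e₀∈d))) d' d'⊆p-e₀ d'⊆c)
        (d'⊆c , e₀ , d⊆c e₀ e₀∈d , d'e₀≈0)
      where
      d'⊆c : ∀ e → InSupp P d' e → InSupp P c e
      d'⊆c e = d⊆c e ∘ d'⊆d e
      d'⊆p-e₀ : ∀ e → InSupp P d' e → e ∈ p without e₀
      d'⊆p-e₀ e e∈d' = x∈p∧x≢y⇒x∈p-y (d⊆p e (d'⊆d e e∈d')) (λ { ≡.refl → e∈d' d'e₀≈0 })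

  x≉0⇒1≉0 : ∀ {a} → ¬ (a ≈ 0#) → ¬ (1# ≈ 0#)
  x≉0⇒1≉0 {a} a≉0 1≈0 = a≉0 (begin
    a       ≈⟨ *-identityʳ a ⟨
    a * 1#  ≈⟨ *-congˡ 1≈0 ⟩
    a * 0#  ≈⟨ zeroʳ a ⟩
    0#      ∎)

  G-cancelʳ : ∀ {a b} → G a → b * a ≈ 0# → b ≈ 0#
  G-cancelʳ {a} {b} Ga ba≈0 with G-inv Ga
  ... | a⁻¹ , _ , aa⁻¹≈1 , _ = begin
    b              ≈⟨ *-identityʳ b ⟨
    b * 1#         ≈⟨ *-congˡ aa⁻¹≈1 ⟨
    b * (a * a⁻¹)  ≈⟨ *-assoc b a a⁻¹ ⟨
    (b * a) * a⁻¹  ≈⟨ *-congʳ ba≈0 ⟩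
    0# * a⁻¹       ≈⟨ zeroˡ a⁻¹ ⟩
    0#             ∎

  G-cancelˡ : ∀ {a b} → G a → a * b ≈ 0# → b ≈ 0#
  G-cancelˡ {a} {b} Ga ab≈0 with G-inv Ga
  ... | a⁻¹ , _ , _ , a⁻¹a≈1 = begin
    b              ≈⟨ *-identityˡ b ⟨
    1# * b         ≈⟨ *-congʳ a⁻¹a≈1 ⟨
    (a⁻¹ * a) * b  ≈⟨ *-assoc a⁻¹ a b ⟩
    a⁻¹ * (a * b)  ≈⟨ *-congˡ ab≈0 ⟩
    a⁻¹ * 0#       ≈⟨ zeroʳ a⁻¹ ⟩
    0#             ∎

  G-inverseˡ : ∀ {a b} → G a → b * a ≈ 1# → G b
  G-inverseˡ {a} {b} Ga ba≈1 with G-inv Ga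
  ... | a⁻¹ , Ga⁻¹ , aa⁻¹≈1 , _ = G-resp (begin
    a⁻¹            ≈⟨ *-identityˡ a⁻¹ ⟨
    1# * a⁻¹       ≈⟨ *-congʳ ba≈1 ⟨
    (b * a) * a⁻¹  ≈⟨ *-assoc b a a⁻¹ ⟩
    b * (a * a⁻¹)  ≈⟨ *-congˡ aa⁻¹≈1 ⟩
    b * 1#         ≈⟨ *-identityʳ b ⟩
    b              ∎) Ga⁻¹

  G⇒invertible : ∀ {a} → G a → Σ[ b ∈ Carrier ] IsInverse P b a
  G⇒invertible Ga with G-inv Ga
  ... | b , _ , ab≈1 , ba≈1 = b , ba≈1 , ab≈1

  Primitive-vanishes : ∀ {n} {d c : Chain P n} {r} → NonZero P d → (∀ e → d e ≈ r * c e) →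
    Primitive P c → ∀ e → ¬ InSupp P d e → c e ≈ 0#
  Primitive-vanishes {d = d} {c} {r} (e₁ , e₁∈d) d≈rc c-primitive e e∉d with c-primitive e
  ... | inj₂ ce≈0 = ce≈0
  ... | inj₁ G-ce = contradiction e∈d e∉d
    where
    e∈d : InSupp P d e
    e∈d de≈0 = contradiction (begin
      d e₁      ≈⟨ d≈rc e₁ ⟩
      r * c e₁  ≈⟨ *-congʳ (G-cancelʳ G-ce (trans (sym (d≈rc e)) de≈0)) ⟩
      0# * c e₁ ≈⟨ zeroˡ (c e₁) ⟩
      0#        ∎) e₁∈d

  module _ {n} {X : Fin n → Bool} {A : Mat P n} where

    IA-out : ∀ r e → X e ≡ false → IA P X A r e ≡ A r e
    IA-out r e Xe rewrite Xe = ≡.refl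

    IA-diag : ∀ e → X e ≡ true → IA P X A e e ≡ 1#
    IA-diag e Xe rewrite Xe | proj₂ (dec-yes (e ≟ e) ≡.refl) = ≡.refl

    IA-off : ∀ r e → X e ≡ true → r ≢ e → IA P X A r e ≡ 0#
    IA-off r e Xe r≢e rewrite Xe | dec-no (r ≟ e) r≢e = ≡.refl

    combination-IA : ∀ {z : Chain P n} {u} → X u ≡ true → combination X z (IA P X A) u ≈ z u
    combination-IA {z} {u} Xu = begin
      combination X z (IA P X A) u            ≈⟨ Σᶠ-single _ u vanish ⟩
      (if X u then z u * IA P X A u u else 0#) ≡⟨ ≡.cong₂ (λ b m → if b then z u * m else 0#) Xu (IA-diag u Xu) ⟩
      z u * 1#                                ≈⟨ *-identityʳ (z u) ⟩
      z u                                     ∎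
      where
      vanish : ∀ r → r ≢ u → (if X r then z r * IA P X A r u else 0#) ≈ 0#
      vanish r r≢u rewrite IA-off r u Xu r≢u = if-0 (X r) (zeroʳ (z r))

    rowspan-IA-multiple : ∀ {x} {c : Chain P n} → X x ≡ true → rowspan P X (IA P X A) c →
      (∀ u → X u ≡ true → u ≢ x → c u ≈ 0#) → ∀ e → c e ≈ c x * IA P X A x e
    rowspan-IA-multiple {x} {c} Xx (z , c≈zM) c≈0 e = begin
      c e                          ≈⟨ c≈zM e ⟩
      combination X z (IA P X A) e ≈⟨ combination-single (IA P X A) Xx z≈0 e ⟩
      z x * IA P X A x e           ≈⟨ *-congʳ (c≈z Xx) ⟨
      c x * IA P X A x e           ∎
      where
      c≈z : ∀ {u} → X u ≡ true → c u ≈ z u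
      c≈z Xu = trans (c≈zM _) (combination-IA Xu)
      z≈0 : ∀ u → X u ≡ true → u ≢ x → z u ≈ 0#
      z≈0 u Xu u≢x = trans (sym (c≈z Xu)) (c≈0 u Xu u≢x)

    IA-row-elementary : ¬ (1# ≈ 0#) → StrongPMatrix P X A → ∀ {x} → X x ≡ true →
      Elementary P (rowspan P X (IA P X A)) (IA P X A x)
    IA-row-elementary 1≉0 strong {x} Xx =
      Elementary-by-descent (rowspan-row Xx) (x , row-x≉0) no-elementary-below
      where
      row : Chain P n
      row = IA P X A x
      row-x≉0 : InSupp P row x
      row-x≉0 rowx≈0 = 1≉0 (trans (sym (reflexive (IA-diag x Xx))) rowx≈0)
      no-elementary-below : ∀ d → Elementary P (rowspan P X (IA P X A)) d → ¬ StrictSubSupp P d row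
      no-elementary-below d d-elementary@(_ , d≢0@(e₁ , e₁∈d) , _) (d⊆row , e₀ , e₀∈row , de₀≈0)
        with strong d d-elementary
      ... | r , c , Cc , c-primitive , d≈rc = by-cases (c-primitive x)
        where
        c-vanishes : ∀ e → ¬ InSupp P d e → c e ≈ 0#
        c-vanishes = Primitive-vanishes d≢0 d≈rc c-primitive
        c≈cx*row : ∀ e → c e ≈ c x * row e
        c≈cx*row = rowspan-IA-multiple Xx Cc λ u Xu u≢x →
          c-vanishes u (λ u∈d → d⊆row u u∈d (reflexive (IA-off x u Xu (λ x≡u → u≢x (≡.sym x≡u)))))
        by-cases : G (c x) ⊎ c x ≈ 0# → ⊥
        by-cases (inj₁ G-cx) =
          e₀∈row (G-cancelˡ G-cx (trans (sym (c≈cx*row e₀)) (c-vanishes e₀ (λ e₀∈d → e₀∈d de₀≈0))))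
        by-cases (inj₂ cx≈0) = e₁∈d (begin
          d e₁                 ≈⟨ d≈rc e₁ ⟩
          r * c e₁             ≈⟨ *-congˡ (c≈cx*row e₁) ⟩
          r * (c x * row e₁)   ≈⟨ *-congˡ (trans (*-congʳ cx≈0) (zeroˡ (row e₁))) ⟩
          r * 0#               ≈⟨ zeroʳ r ⟩
          0#                   ∎)

    strong-entry∈G : StrongPMatrix P X A → ∀ {x y} → X x ≡ true → X y ≡ false →
      ¬ (A x y ≈ 0#) → G (A x y)
    strong-entry∈G strong {x} {y} Xx Xy Axy≉0
      with strong (IA P X A x) (IA-row-elementary (x≉0⇒1≉0 Axy≉0) strong Xx)
    ... | r , c , _ , c-primitive , row≈rc = G-resp (sym Axy≈rcy) (G-mul G-r (G-entry y Axy≈rcy Axy≉0))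
      where
      Axy≈rcy : A x y ≈ r * c y
      Axy≈rcy = trans (sym (reflexive (IA-out x y Xy))) (row≈rc y)
      1≈rcx : 1# ≈ r * c x
      1≈rcx = trans (sym (reflexive (IA-diag x Xx))) (row≈rc x)
      G-entry : ∀ e {a} → a ≈ r * c e → ¬ (a ≈ 0#) → G (c e)
      G-entry e a≈rce a≉0 with c-primitive e
      ... | inj₁ G-ce = G-ce
      ... | inj₂ ce≈0 = contradiction (trans a≈rce (trans (*-congˡ ce≈0) (zeroʳ r))) a≉0
      G-r : G r
      G-r = G-inverseˡ (G-entry x 1≈rcx (x≉0⇒1≉0 Axy≉0)) (sym 1≈rcx)

  separated-by : ∀ {n} {T : Fin n → Bool} {u v} → T u ≡ true → T v ≡ false → u ≢ v
  separated-by {T = T} Tu Tv u≡v with ≡.trans (≡.sym Tu) (≡.trans (≡.cong T u≡v) Tv)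
  ... | ()

  module _ {n} {X : Fin n → Bool} {x y : Fin n} where

    pivotRows-x : pivotRows P X x y x ≡ false
    pivotRows-x rewrite proj₂ (dec-yes (x ≟ x) ≡.refl) = ≡.refl

    pivotRows-y : y ≢ x → pivotRows P X x y y ≡ true
    pivotRows-y y≢x rewrite dec-no (y ≟ x) y≢x | proj₂ (dec-yes (y ≟ y) ≡.refl) = ≡.refl

    pivotRows-other : ∀ {e} → e ≢ x → e ≢ y → pivotRows P X x y e ≡ X e
    pivotRows-other {e} e≢x e≢y rewrite dec-no (e ≟ x) e≢x | dec-no (e ≟ y) e≢y = ≡.refl

  module _ {n} {A : Mat P n} {x y : Fin n} {a' : Carrier} where

    pivot-yx : pivot P A x y a' y x ≡ a'
    pivot-yx rewrite proj₂ (dec-yes (y ≟ y) ≡.refl) | proj₂ (dec-yes (x ≟ x) ≡.refl) = ≡.refl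

    pivot-y : ∀ {v} → v ≢ x → pivot P A x y a' y v ≡ a' * A x v
    pivot-y {v} v≢x rewrite proj₂ (dec-yes (y ≟ y) ≡.refl) | dec-no (v ≟ x) v≢x = ≡.refl

    pivot-x : ∀ {u} → u ≢ y → pivot P A x y a' u x ≡ - (A u y * a')
    pivot-x {u} u≢y rewrite dec-no (u ≟ y) u≢y | proj₂ (dec-yes (x ≟ x) ≡.refl) = ≡.refl

    pivot-other : ∀ {u v} → u ≢ y → v ≢ x → pivot P A x y a' u v ≡ A u v - A u y * a' * A x v
    pivot-other {u} {v} u≢y v≢x rewrite dec-no (u ≟ y) u≢y | dec-no (v ≟ x) v≢x = ≡.refl

  IA-unit-column : ∀ {n} {X X' : Fin n → Bool} {A B : Mat P n} r e → X e ≡ true → X' e ≡ true →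
    IA P X A r e ≡ IA P X' B r e
  IA-unit-column r e Xe X'e rewrite Xe | X'e with r ≟ e
  ... | yes _ = ≡.refl
  ... | no  _ = ≡.refl

  module _ {n} {X : Fin n → Bool} {A : Mat P n} {x y : Fin n} {a' : Carrier}
           (Xx : X x ≡ true) (Xy : X y ≡ false) (a'A≈1 : a' * A x y ≈ 1#) (Aa'≈1 : A x y * a' ≈ 1#) where

    private
      X' : Fin n → Bool
      X' = pivotRows P X x y
      B : Mat P n
      B = pivot P A x y a'
      M : Mat P n
      M = IA P X A
      M' : Mat P n
      M' = IA P X' B

      y≢x : y ≢ x
      y≢x y≡x = separated-by Xx Xy (≡.sym y≡x)

      X'x : X' x ≡ false
      X'x = pivotRows-x {X = X} {x} {y}

      X'y : X' y ≡ true
      X'y = pivotRows-y {X = X} y≢x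

      X'≡X : ∀ {e b} → e ≢ x → e ≢ y → X e ≡ b → X' e ≡ b
      X'≡X e≢x e≢y Xe = ≡.trans (pivotRows-other {X = X} e≢x e≢y) Xe

      -- A view rather than `with e ≟ x`: abstracting that decision would also rewrite
      -- it inside the stuck with-definitions of pivotRows and pivot in the goal.
      data Column (e : Fin n) : Set where
        column-x    : e ≡ x → Column e
        column-y    : e ≡ y → Column e
        column-unit : e ≢ x → e ≢ y → X e ≡ true → Column e
        column-A    : e ≢ x → e ≢ y → X e ≡ false → Column e

      column : ∀ e → Column e
      column e with e ≟ x | e ≟ y | X e in Xe
      ... | yes e≡x | _       | _     = column-x e≡x
      ... | no  e≢x | yes e≡y | _     = column-y e≡y
      ... | no  e≢x | no  e≢y | true  = column-unit e≢x e≢y Xe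
      ... | no  e≢x | no  e≢y | false = column-A e≢x e≢y Xe

    pivot-row-y : ∀ e → M' y e ≈ a' * M x e
    pivot-row-y e with column e
    ... | column-x ≡.refl = begin
      M' y x      ≡⟨ IA-out {X = X'} {A = B} y x X'x ⟩
      B y x       ≡⟨ pivot-yx {A = A} {x} {y} {a'} ⟩
      a'          ≈⟨ *-identityʳ a' ⟨
      a' * 1#     ≡⟨ ≡.cong (a' *_) (IA-diag {X = X} {A = A} x Xx) ⟨
      a' * M x x  ∎
    ... | column-y ≡.refl = begin
      M' y y      ≡⟨ IA-diag {X = X'} {A = B} y X'y ⟩
      1#          ≈⟨ a'A≈1 ⟨
      a' * A x y  ≡⟨ ≡.cong (a' *_) (IA-out {X = X} {A = A} x y Xy) ⟨
      a' * M x y  ∎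
    ... | column-unit e≢x e≢y Xe = begin
      M' y e      ≡⟨ IA-off {X = X'} {A = B} y e (X'≡X e≢x e≢y Xe) (λ y≡e → e≢y (≡.sym y≡e)) ⟩
      0#          ≈⟨ zeroʳ a' ⟨
      a' * 0#     ≡⟨ ≡.cong (a' *_) (IA-off {X = X} {A = A} x e Xe (λ x≡e → e≢x (≡.sym x≡e))) ⟨
      a' * M x e  ∎
    ... | column-A e≢x e≢y Xe = begin
      M' y e      ≡⟨ IA-out {X = X'} {A = B} y e (X'≡X e≢x e≢y Xe) ⟩
      B y e       ≡⟨ pivot-y {A = A} {y = y} {a'} e≢x ⟩
      a' * A x e  ≡⟨ ≡.cong (a' *_) (IA-out {X = X} {A = A} x e Xe) ⟨
      a' * M x e  ∎

    pivot-row-other : ∀ {s} → X s ≡ true → s ≢ x → ∀ e → M' s e ≈ M s e + - (A s y * a') * M x e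
    pivot-row-other {s} Xs s≢x e with s≢y ← separated-by Xs Xy | column e
    ... | column-x ≡.refl = begin
      M' s x                          ≡⟨ IA-out {X = X'} {A = B} s x X'x ⟩
      B s x                           ≡⟨ pivot-x {A = A} {x} {y} {a'} s≢y ⟩
      - (A s y * a')                  ≈⟨ *-identityʳ _ ⟨
      - (A s y * a') * 1#             ≈⟨ +-identityˡ _ ⟨
      0# + - (A s y * a') * 1#        ≡⟨ ≡.cong₂ (λ p q → p + - (A s y * a') * q)
                                           (IA-off {X = X} {A = A} s x Xx s≢x) (IA-diag {X = X} {A = A} x Xx) ⟨
      M s x + - (A s y * a') * M x x  ∎
    ... | column-y ≡.refl = begin
      M' s y                          ≡⟨ IA-off {X = X'} {A = B} s y X'y s≢y ⟩
      0#                              ≈⟨ -‿inverseʳ (A s y) ⟨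
      A s y + - A s y                 ≈⟨ +-congˡ (begin
        - (A s y * a') * A x y          ≈⟨ -‿distribˡ-* _ _ ⟨
        - (A s y * a' * A x y)          ≈⟨ -‿cong (*-assoc _ _ _) ⟩
        - (A s y * (a' * A x y))        ≈⟨ -‿cong (*-congˡ a'A≈1) ⟩
        - (A s y * 1#)                  ≈⟨ -‿cong (*-identityʳ _) ⟩
        - A s y                         ∎) ⟨
      A s y + - (A s y * a') * A x y  ≡⟨ ≡.cong₂ (λ p q → p + - (A s y * a') * q)
                                           (IA-out {X = X} {A = A} s y Xy) (IA-out {X = X} {A = A} x y Xy) ⟨
      M s y + - (A s y * a') * M x y  ∎
    ... | column-unit e≢x e≢y Xe = begin
      M' s e                          ≡⟨ IA-unit-column {X = X} {X'} {A} {B} s e Xe (X'≡X e≢x e≢y Xe) ⟨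
      M s e                           ≈⟨ +-identityʳ _ ⟨
      M s e + 0#                      ≈⟨ +-congˡ (zeroʳ _) ⟨
      M s e + - (A s y * a') * 0#     ≡⟨ ≡.cong (λ q → M s e + - (A s y * a') * q)
                                           (IA-off {X = X} {A = A} x e Xe (λ x≡e → e≢x (≡.sym x≡e))) ⟨
      M s e + - (A s y * a') * M x e  ∎
    ... | column-A e≢x e≢y Xe = begin
      M' s e                          ≡⟨ IA-out {X = X'} {A = B} s e (X'≡X e≢x e≢y Xe) ⟩
      B s e                           ≡⟨ pivot-other {A = A} {x} {y} {a'} s≢y e≢x ⟩
      A s e - A s y * a' * A x e      ≈⟨ +-congˡ (-‿distribˡ-* _ _) ⟩
      A s e + - (A s y * a') * A x e  ≡⟨ ≡.cong₂ (λ p q → p + - (A s y * a') * q)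
                                           (IA-out {X = X} {A = A} s e Xe) (IA-out {X = X} {A = A} x e Xe) ⟨
      M s e + - (A s y * a') * M x e  ∎

    pivot-rows∈rowspan : ∀ s → X' s ≡ true → rowspan P X M (M' s)
    pivot-rows∈rowspan s X's with s ≟ y
    ... | yes ≡.refl = rowspan-resp (λ e → sym (pivot-row-y e)) (rowspan-*ˡ a' (rowspan-row Xx))
    ... | no s≢y = rowspan-resp (λ e → sym (pivot-row-other Xs s≢x e))
                     (rowspan-+ (rowspan-row Xs) (rowspan-*ˡ (- (A s y * a')) (rowspan-row Xx)))
      where
      s≢x : s ≢ x
      s≢x = separated-by X's X'x
      Xs : X s ≡ true
      Xs = ≡.trans (≡.sym (pivotRows-other {X = X} s≢x s≢y)) X's

    rows∈pivot-rowspan : ∀ s → X s ≡ true → rowspan P X' M' (M s)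
    rows∈pivot-rowspan s Xs with s ≟ x
    ... | yes ≡.refl = rowspan-resp row-x≈ (rowspan-*ˡ (A x y) (rowspan-row X'y))
      where
      row-x≈ : ∀ e → A x y * M' y e ≈ M x e
      row-x≈ e = begin
        A x y * M' y e        ≈⟨ *-congˡ (pivot-row-y e) ⟩
        A x y * (a' * M x e)  ≈⟨ *-assoc _ _ _ ⟨
        (A x y * a') * M x e  ≈⟨ *-congʳ Aa'≈1 ⟩
        1# * M x e            ≈⟨ *-identityˡ _ ⟩
        M x e                 ∎
    ... | no s≢x = rowspan-resp row-s≈
                     (rowspan-+ (rowspan-row (X'≡X s≢x (separated-by Xs Xy) Xs))
                                (rowspan-*ˡ (A s y) (rowspan-row X'y)))
      where
      row-s≈ : ∀ e → M' s e + A s y * M' y e ≈ M s e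
      row-s≈ e = begin
        M' s e + A s y * M' y e                                   ≈⟨ +-cong (pivot-row-other Xs s≢x e) (*-congˡ (pivot-row-y e)) ⟩
        (M s e + - (A s y * a') * M x e) + A s y * (a' * M x e)   ≈⟨ +-congˡ (*-assoc _ _ _) ⟨
        (M s e + - (A s y * a') * M x e) + (A s y * a') * M x e   ≈⟨ +-assoc _ _ _ ⟩
        M s e + (- (A s y * a') * M x e + (A s y * a') * M x e)   ≈⟨ +-congˡ (distribʳ _ _ _) ⟨
        M s e + (- (A s y * a') + A s y * a') * M x e             ≈⟨ +-congˡ (*-congʳ (-‿inverseˡ _)) ⟩
        M s e + 0# * M x e                                        ≈⟨ +-congˡ (zeroˡ _) ⟩
        M s e + 0#                                                ≈⟨ +-identityʳ _ ⟩
        M s e                                                     ∎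

    StrongPMatrix-pivot : StrongPMatrix P X A → StrongPMatrix P X' B
    StrongPMatrix-pivot = IsPChainGroup-resp (rowspan-⊆ rows∈pivot-rowspan) (rowspan-⊆ pivot-rows∈rowspan)

lemma3p28 : ∀ {c ℓ g : Level} (P : SkewPartialField c ℓ g) {n : ℕ}
  (X : Fin n → Bool) (A : Mat P n) (x y : Fin n) →
  X x ≡ true → X y ≡ false →
  StrongPMatrix P X A →
  ¬ (SkewPartialField._≈_ P (A x y) (SkewPartialField.0# P)) →
  (Σ[ a' ∈ SkewPartialField.Carrier P ] IsInverse P a' (A x y))
  × (∀ a' → IsInverse P a' (A x y) →
     StrongPMatrix P (pivotRows P X x y) (pivot P A x y a'))
lemma3p28 P X A x y Xx Xy strong Axy≉0 =
  G⇒invertible P (strong-entry∈G P strong Xx Xy Axy≉0) ,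
  λ a' (a'A≈1 , Aa'≈1) → StrongPMatrix-pivot P Xx Xy a'A≈1 Aa'≈1 strong
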